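{- Let $\pi^{:}=(\pi,col)$ be a decorated permutation of $[n]$ with Grassmann necklace $(I_1,\dots,I_n)$ and upper Grassmann necklace $(J_1,\dots,J_n)$, and let $$\tilde{\mathcal{M}}_{\pi^{:}}=\bigcap_{i=1}^{n}\tilde{SM}^{i}_{J_i}.$$ Then for every $H\in\tilde{\mathcal{M}}_{\pi^{:}}$ and every $i\in[n]$ we have $H\ge_i \pi(J_i)=I_i$.
   Context: For $t\in[n]$, $<_t$ is the total order $t<_t t+1<_t\cdots<_t n<_t 1<_t\cdots<_t t-1$; for $k$-sets $I=\{i_1<_t\cdots<_t i_k\}$, $J=\{j_1<_t\cdots<_t j_k\}$, $I\le_t J$ iff $i_r\le_t j_r$ for all $r$. The cyclically shifted dual Schubert matroid is $\tilde{SM}^t_I=\{H\in\binom{[n]}{k}: I\ge_t H\}$. A decorated permutation is a pair $(\pi,col)$ with $\pi\in S_n$ and $col$ a function from the fixed points of $\pi$ to $\{1,-1\}$. Its Grassmann necklace is $I_r=\{j\in[n]: j<_r\pi^{ -1}(j)\text{ or }(\pi(j)=j\text{ and }col(j)=-1)\}$ and its upper Grassmann necklace is $J_r=\{i\in[n]: \pi(i)<_r i\text{ or }(\pi(i)=i\text{ and }col(i)=-1)\}$, for $r\in[n]$; here $k=|I_r|=|J_r|$. -}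

module Defs where

open import Data.Nat using (ℕ; _∸_; _+_; _≤_; _<ᵇ_; _≤ᵇ_)
open import Data.Bool using (Bool; true; false; not; _∨_; if_then_else_)
open import Data.Fin using (Fin; toℕ; _≟_)
open import Data.List using (List; filterᵇ; allFin; _++_; length)
open import Data.List.Relation.Binary.Pointwise using (Pointwise)
open import Data.Fin.Permutation using (Permutation′; _⟨$⟩ʳ_; _⟨$⟩ˡ_)
open import Data.Sign using (Sign)
open import Data.Product using (_×_)
open import Relation.Binary.PropositionalEquality using (_≡_)
open import Relation.Nullary using (yes; no)

-- Convention: [n] is represented by Fin n (element j ∈ Fin n stands for j+1).
-- A subset of [n] is a Boolean predicate Fin n → Bool.
Subset : ℕ → Set
Subset n = Fin n → Bool

-- rank of j in the order <_t : t ↦ 0, t+1 ↦ 1, …, t-1 ↦ n-1.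
rank : ∀ {n} → Fin n → Fin n → ℕ
rank {n} t j = if toℕ t ≤ᵇ toℕ j then toℕ j ∸ toℕ t else (n ∸ toℕ t) + toℕ j

_<[_]_ : ∀ {n} → Fin n → Fin n → Fin n → Bool
a <[ t ] b = rank t a <ᵇ rank t b

orderedFin : ∀ {n} → Fin n → List (Fin n)
orderedFin {n} t = filterᵇ (λ j → toℕ t ≤ᵇ toℕ j) (allFin n)
                ++ filterᵇ (λ j → not (toℕ t ≤ᵇ toℕ j)) (allFin n)

sorted : ∀ {n} → Fin n → Subset n → List (Fin n)
sorted t I = filterᵇ I (orderedFin t)

card : ∀ {n} → Subset n → ℕ
card {n} I = length (filterᵇ I (allFin n))

GaleLeq : ∀ {n} → Fin n → Subset n → Subset n → Set
GaleLeq t I J = Pointwise (λ a b → rank t a ≤ rank t b) (sorted t I) (sorted t J)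

InSM : ∀ {n} → Fin n → Subset n → Subset n → Set
InSM t I H = card H ≡ card I × GaleLeq t H I

-- decorated permutation: permutation and a colouring of its fixed points (Sign: + is 1, - is -1)
record DecPerm (n : ℕ) : Set where
  field
    perm : Permutation′ n
    col  : (j : Fin n) → perm ⟨$⟩ʳ j ≡ j → Sign
open DecPerm public

fixedNeg : ∀ {n} → DecPerm n → Fin n → Bool
fixedNeg d j with (perm d ⟨$⟩ʳ j) ≟ j
... | no _ = false
... | yes p with col d j p
...   | Sign.- = true
...   | Sign.+ = false

necklace : ∀ {n} → DecPerm n → Fin n → Subset n
necklace d r j = (j <[ r ] (perm d ⟨$⟩ˡ j)) ∨ fixedNeg d j

upperNecklace : ∀ {n} → DecPerm n → Fin n → Subset n
upperNecklace d r i = ((perm d ⟨$⟩ʳ i) <[ r ] i) ∨ fixedNeg d i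

image : ∀ {n} → Permutation′ n → Subset n → Subset n
image π S j = S (π ⟨$⟩ˡ j)

InMtilde : ∀ {n} → DecPerm n → Subset n → Set
InMtilde d H = ∀ i → InSM i (upperNecklace d i) H

module Submission where

-- For sets of equal size, A ≤_t B holds iff every initial segment of
-- the order <_t contains at least as many elements of A as of B.  Fix i and
-- k < n, let t be the element of rank k in <_i and W the first k elements of
-- <_i.  In <_t the window W is the final segment of length k, so H ≤_t J_t
-- gives |W ∩ H| ≤ |W ∩ J_t|.  Inside W the orders <_i and <_t agree, W comes
-- last in <_t and first in <_i; hence |W ∩ J_t| = |W ∩ π(J_i)|, the elements
-- that π moves out of W balancing those it moves into W.

open import Defs
open import Data.Nat using (ℕ; zero; suc; _+_; _∸_; _≤_; _<_; _≤ᵇ_; _<ᵇ_; z≤n; s≤s; s≤s⁻¹; _≤?_; _<?_; _%_; NonZero)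
open import Data.Nat.Properties hiding (_≟_)
open import Data.Nat.DivMod using (m<n⇒m%n≡m; [m+n]%n≡m%n; %-distribˡ-+; m%n<n; m%n%n≡m%n)
open import Data.Nat.Tactic.RingSolver using (solve-∀)
open import Data.Bool using (Bool; true; false; not; _∧_; _∨_; T)
open import Data.Bool.Properties using (∧-comm; T-≡; T-not-≡)
open import Data.Fin as Fin using (Fin; toℕ; fromℕ<; _≟_)
open import Data.Fin.Properties using (toℕ<n; nonZeroIndex; toℕ-fromℕ<)
open import Data.Fin.Permutation using (Permutation′; _⟨$⟩ʳ_; _⟨$⟩ˡ_; inverseˡ; inverseʳ; flip)
open import Data.List using (List; []; _∷_; filterᵇ; allFin; _++_; length; map; tabulate)
open import Data.List.Properties using (length-++; filter-++; length-map)
open import Data.List.Relation.Unary.All as All using (All; []; _∷_)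
open import Data.List.Relation.Unary.All.Properties using (all-filter)
open import Data.List.Relation.Unary.AllPairs using (AllPairs; []; _∷_)
import Data.List.Relation.Unary.AllPairs.Properties as AllPairs
open import Data.List.Relation.Binary.Pointwise as Pointwise using (Pointwise; []; _∷_; Pointwise-length)
open import Data.Product using (Σ; _×_; _,_; proj₁; proj₂)
open import Data.Sum using (_⊎_; inj₁; inj₂)
open import Algebra.Properties.CommutativeMonoid.Sum +-0-commutativeMonoid using (sum; sum-permute)
open import Relation.Binary.PropositionalEquality
  using (_≡_; refl; sym; trans; cong; cong₂; subst; subst₂; module ≡-Reasoning)
open import Relation.Nullary using (Dec; yes; no; ¬_; contradiction)
open import Relation.Nullary.Decidable using (T?)
open import Function using (Equivalence; _∘_)

-- Intersection and complement of Boolean predicates.  Splitting a count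
-- along q always puts q in front, so that fixing the value of q makes
-- the conjunction compute.
_∩_ : {A : Set} → (A → Bool) → (A → Bool) → A → Bool
(p ∩ q) x = p x ∧ q x

∁ : {A : Set} → (A → Bool) → A → Bool
∁ p x = not (p x)

count : {A : Set} → (A → Bool) → List A → ℕ
count p xs = length (filterᵇ p xs)

count-∷-true : {A : Set} {p : A → Bool} {x : A} (xs : List A) →
               p x ≡ true → count p (x ∷ xs) ≡ suc (count p xs)
count-∷-true xs px rewrite px = refl

count-∷-false : {A : Set} {p : A → Bool} {x : A} (xs : List A) →
                p x ≡ false → count p (x ∷ xs) ≡ count p xs
count-∷-false xs px rewrite px = refl

count-cong : {A : Set} {p q : A → Bool} → (∀ x → p x ≡ q x) → (xs : List A) →
             count p xs ≡ count q xs
count-cong p≗q [] = refl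
count-cong {p = p} {q} p≗q (x ∷ xs) with p x | q x | p≗q x
... | true  | true  | refl = cong suc (count-cong p≗q xs)
... | false | false | refl = count-cong p≗q xs

count-split : {A : Set} (q p : A → Bool) (xs : List A) →
              count p xs ≡ count (q ∩ p) xs + count (∁ q ∩ p) xs
count-split q p [] = refl
count-split q p (x ∷ xs) with q x | p x
... | true  | true  = cong suc (count-split q p xs)
... | true  | false = count-split q p xs
... | false | true  = trans (cong suc (count-split q p xs)) (sym (+-suc _ _))
... | false | false = count-split q p xs

count-++ : {A : Set} (p : A → Bool) (xs ys : List A) →
           count p (xs ++ ys) ≡ count p xs + count p ys
count-++ p xs ys = trans (cong length (filter-++ (T? ∘ p) xs ys)) (length-++ (filterᵇ p xs))

count-filter : {A : Set} (q p : A → Bool) (xs : List A) →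
               count q (filterᵇ p xs) ≡ count (q ∩ p) xs
count-filter q p [] = refl
count-filter q p (x ∷ xs) with p x
... | false with q x
...   | true  = count-filter q p xs
...   | false = count-filter q p xs
count-filter q p (x ∷ xs) | true with q x
...   | true  = cong suc (count-filter q p xs)
...   | false = count-filter q p xs

count-map : {A B : Set} (q : B → Bool) (f : A → B) (xs : List A) →
            count q (map f xs) ≡ count (q ∘ f) xs
count-map q f [] = refl
count-map q f (x ∷ xs) with q (f x)
... | true  = cong suc (count-map q f xs)
... | false = count-map q f xs

count-≤-∷ : {A : Set} (p : A → Bool) (x : A) (xs : List A) → count p xs ≤ count p (x ∷ xs)
count-≤-∷ p x xs with p x
... | true  = n≤1+n (count p xs)
... | false = ≤-refl

count-orderedFin : ∀ {n} (t : Fin n) (p : Subset n) → count p (orderedFin t) ≡ card p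
count-orderedFin {n} t p = begin
  count p (filterᵇ P (allFin n) ++ filterᵇ (∁ P) (allFin n))
    ≡⟨ count-++ p (filterᵇ P (allFin n)) _ ⟩
  count p (filterᵇ P (allFin n)) + count p (filterᵇ (∁ P) (allFin n))
    ≡⟨ cong₂ _+_ (count-filter p P (allFin n)) (count-filter p (∁ P) (allFin n)) ⟩
  count (p ∩ P) (allFin n) + count (p ∩ ∁ P) (allFin n)
    ≡⟨ cong₂ _+_ (count-cong (λ j → ∧-comm (p j) (P j)) (allFin n))
                 (count-cong (λ j → ∧-comm (p j) (∁ P j)) (allFin n)) ⟩
  count (P ∩ p) (allFin n) + count (∁ P ∩ p) (allFin n)
    ≡⟨ count-split P p (allFin n) ⟨
  card p ∎
  where
  open ≡-Reasoning
  P : Subset n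
  P j = toℕ t ≤ᵇ toℕ j

indicator : Bool → ℕ
indicator true  = 1
indicator false = 0

count-tabulate : ∀ {A : Set} {m} (p : A → Bool) (f : Fin m → A) →
                 count p (tabulate f) ≡ sum (indicator ∘ p ∘ f)
count-tabulate {m = zero}  p f = refl
count-tabulate {m = suc m} p f with p (f Fin.zero)
... | true  = cong suc (count-tabulate p (f ∘ Fin.suc))
... | false = count-tabulate p (f ∘ Fin.suc)

card-permute : ∀ {n} (π : Permutation′ n) (A : Subset n) → card (A ∘ (π ⟨$⟩ʳ_)) ≡ card A
card-permute π A = begin
  card (A ∘ (π ⟨$⟩ʳ_))            ≡⟨ count-tabulate (A ∘ (π ⟨$⟩ʳ_)) (λ j → j) ⟩
  sum (indicator ∘ A ∘ (π ⟨$⟩ʳ_)) ≡⟨ sum-permute (indicator ∘ A) π ⟨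
  sum (indicator ∘ A)             ≡⟨ count-tabulate A (λ j → j) ⟨
  card A                          ∎
  where open ≡-Reasoning

card-difference : ∀ {n} (A B : Subset n) → card A ≡ card B → card (∁ B ∩ A) ≡ card (∁ A ∩ B)
card-difference {n} A B |A|≡|B| = +-cancelˡ-≡ (card (A ∩ B)) _ _ (begin
  card (A ∩ B) + card (∁ B ∩ A) ≡⟨ cong (_+ card (∁ B ∩ A)) (count-cong (λ j → ∧-comm (A j) (B j)) (allFin n)) ⟩
  card (B ∩ A) + card (∁ B ∩ A) ≡⟨ count-split B A (allFin n) ⟨
  card A                        ≡⟨ |A|≡|B| ⟩
  card B                        ≡⟨ count-split A B (allFin n) ⟩
  card (A ∩ B) + card (∁ A ∩ B) ∎)
  where open ≡-Reasoning

card-complement-≤ : ∀ {n} (q A B : Subset n) → card A ≡ card B →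
                    card (q ∩ B) ≤ card (q ∩ A) → card (∁ q ∩ A) ≤ card (∁ q ∩ B)
card-complement-≤ {n} q A B |A|≡|B| qB≤qA = +-cancelˡ-≤ (card (q ∩ B)) _ _ (begin
  card (q ∩ B) + card (∁ q ∩ A) ≤⟨ +-monoˡ-≤ _ qB≤qA ⟩
  card (q ∩ A) + card (∁ q ∩ A) ≡⟨ count-split q A (allFin n) ⟨
  card A                        ≡⟨ |A|≡|B| ⟩
  card B                        ≡⟨ count-split q B (allFin n) ⟩
  card (q ∩ B) + card (∁ q ∩ B) ∎)
  where open ≤-Reasoning

<ᵇ-true : ∀ {m n} → m < n → (m <ᵇ n) ≡ true
<ᵇ-true m<n = Equivalence.to T-≡ (<⇒<ᵇ m<n)

<ᵇ-true⇒< : ∀ {m n} → (m <ᵇ n) ≡ true → m < n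
<ᵇ-true⇒< {m} {n} eq = <ᵇ⇒< m n (Equivalence.from T-≡ eq)

<ᵇ-false : ∀ {m n} → n ≤ m → (m <ᵇ n) ≡ false
<ᵇ-false {m} {n} n≤m with m <ᵇ n in eq
... | false = refl
... | true  = contradiction n≤m (<⇒≱ (<ᵇ-true⇒< eq))

<ᵇ-false⇒≥ : ∀ {m n} → (m <ᵇ n) ≡ false → n ≤ m
<ᵇ-false⇒≥ eq = ≮⇒≥ (λ m<n → contradiction (trans (sym (<ᵇ-true m<n)) eq) λ ())

<ᵇ-shift : ∀ {a a′ b b′ c d} → a + c ≡ b + d → a′ + c ≡ b′ + d → (a <ᵇ a′) ≡ (b <ᵇ b′)
<ᵇ-shift {a} {a′} {b} {b′} {c} {d} a+c≡b+d a′+c≡b′+d with b <? b′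
... | yes b<b′ = trans (<ᵇ-true (+-cancelʳ-< c a a′ (subst₂ _<_ (sym a+c≡b+d) (sym a′+c≡b′+d) (+-monoˡ-< d b<b′))))
                       (sym (<ᵇ-true b<b′))
... | no  b≮b′ = trans (<ᵇ-false (+-cancelʳ-≤ c a′ a (subst₂ _≤_ (sym a′+c≡b′+d) (sym a+c≡b+d) (+-monoˡ-≤ d (≮⇒≥ b≮b′)))))
                       (sym (<ᵇ-false (≮⇒≥ b≮b′)))

countBelow : ℕ → List ℕ → ℕ
countBelow k = count (_<ᵇ k)

countBelow-∷-< : ∀ {k x} (xs : List ℕ) → x < k → countBelow k (x ∷ xs) ≡ suc (countBelow k xs)
countBelow-∷-< xs x<k = count-∷-true xs (<ᵇ-true x<k)

countBelow-∷-≥ : ∀ {k x} (xs : List ℕ) → k ≤ x → countBelow k (x ∷ xs) ≡ countBelow k xs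
countBelow-∷-≥ xs k≤x = count-∷-false xs (<ᵇ-false k≤x)

countBelow-above : ∀ {k} {xs : List ℕ} → All (k ≤_) xs → countBelow k xs ≡ 0
countBelow-above []                        = refl
countBelow-above {xs = x ∷ xs} (k≤x ∷ k≤xs) = trans (countBelow-∷-≥ xs k≤x) (countBelow-above k≤xs)

pointwise⇒countBelow : ∀ {xs ys : List ℕ} → Pointwise _≤_ xs ys →
                       ∀ k → countBelow k ys ≤ countBelow k xs
pointwise⇒countBelow [] k = z≤n
pointwise⇒countBelow {x ∷ xs} {y ∷ ys} (x≤y ∷ xs≤ys) k with y <? k
... | yes y<k = begin
  countBelow k (y ∷ ys)  ≡⟨ countBelow-∷-< ys y<k ⟩
  suc (countBelow k ys)  ≤⟨ s≤s (pointwise⇒countBelow xs≤ys k) ⟩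
  suc (countBelow k xs)  ≡⟨ countBelow-∷-< xs (≤-<-trans x≤y y<k) ⟨
  countBelow k (x ∷ xs)  ∎
  where open ≤-Reasoning
... | no  y≮k = begin
  countBelow k (y ∷ ys)  ≡⟨ countBelow-∷-≥ ys (≮⇒≥ y≮k) ⟩
  countBelow k ys        ≤⟨ pointwise⇒countBelow xs≤ys k ⟩
  countBelow k xs        ≤⟨ count-≤-∷ (_<ᵇ k) x xs ⟩
  countBelow k (x ∷ xs)  ∎
  where open ≤-Reasoning

countBelow⇒pointwise : ∀ {xs ys : List ℕ} → AllPairs _<_ xs → AllPairs _<_ ys →
                       length xs ≡ length ys → (∀ k → countBelow k ys ≤ countBelow k xs) →
                       Pointwise _≤_ xs ys
countBelow⇒pointwise {[]}     {[]}     _ _ _ _ = []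
countBelow⇒pointwise {x ∷ xs} {y ∷ ys} (x<xs ∷ xs↑) (y<ys ∷ ys↑) |xs|≡|ys| below =
  head-≤ ∷ countBelow⇒pointwise xs↑ ys↑ (suc-injective |xs|≡|ys|) tail-below
  where
  -- if y < x, the prefix count below y+1 is positive for y∷ys but zero for x∷xs
  head-≤ : x ≤ y
  head-≤ with x ≤? y
  ... | yes x≤y = x≤y
  ... | no  x≰y = contradiction (begin
    suc (countBelow (suc y) ys)  ≡⟨ countBelow-∷-< ys ≤-refl ⟨
    countBelow (suc y) (y ∷ ys)  ≤⟨ below (suc y) ⟩
    countBelow (suc y) (x ∷ xs)  ≡⟨ countBelow-above (y<x ∷ All.map (<-trans y<x) x<xs) ⟩
    0                            ∎) λ ()
    where
    open ≤-Reasoning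
    y<x : y < x
    y<x = ≰⇒> x≰y
  tail-below : ∀ k → countBelow k ys ≤ countBelow k xs
  tail-below k with k ≤? y
  ... | yes k≤y = ≤-trans (≤-reflexive (countBelow-above (All.map (λ y<z → ≤-trans k≤y (<⇒≤ y<z)) y<ys))) z≤n
  ... | no  k≰y = s≤s⁻¹ (begin
    suc (countBelow k ys)  ≡⟨ countBelow-∷-< ys y<k ⟨
    countBelow k (y ∷ ys)  ≤⟨ below k ⟩
    countBelow k (x ∷ xs)  ≡⟨ countBelow-∷-< xs (≤-<-trans head-≤ y<k) ⟩
    suc (countBelow k xs)  ∎)
    where
    open ≤-Reasoning
    y<k : y < k
    y<k = ≰⇒> k≰y

≤ᵇ-true : ∀ {m n} → m ≤ n → (m ≤ᵇ n) ≡ true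
≤ᵇ-true m≤n = Equivalence.to T-≡ (≤⇒≤ᵇ m≤n)

≤ᵇ-false : ∀ {m n} → n < m → (m ≤ᵇ n) ≡ false
≤ᵇ-false {m} {n} n<m with m ≤ᵇ n in eq
... | false = refl
... | true  = contradiction (≤ᵇ⇒≤ m n (Equivalence.from T-≡ eq)) (<⇒≱ n<m)

≤ᵇ-false⇒> : ∀ {m n} → (m ≤ᵇ n) ≡ false → n < m
≤ᵇ-false⇒> {m} {n} eq with m ≤? n
... | yes m≤n = contradiction (trans (sym (≤ᵇ-true m≤n)) eq) λ ()
... | no  m≰n = ≰⇒> m≰n

rank-≤ : ∀ {n} (t j : Fin n) → toℕ t ≤ toℕ j → rank t j ≡ toℕ j ∸ toℕ t
rank-≤ t j t≤j rewrite ≤ᵇ-true t≤j = refl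

rank-> : ∀ {n} (t j : Fin n) → toℕ j < toℕ t → rank t j ≡ n ∸ toℕ t + toℕ j
rank-> t j j<t rewrite ≤ᵇ-false j<t = refl

rank<n : ∀ {n} (t j : Fin n) → rank t j < n
rank<n {n} t j with toℕ t ≤? toℕ j
... | yes t≤j = begin-strict
  rank t j       ≡⟨ rank-≤ t j t≤j ⟩
  toℕ j ∸ toℕ t  ≤⟨ m∸n≤m (toℕ j) (toℕ t) ⟩
  toℕ j          <⟨ toℕ<n j ⟩
  n              ∎
  where open ≤-Reasoning
... | no  t≰j = begin-strict
  rank t j               ≡⟨ rank-> t j (≰⇒> t≰j) ⟩
  n ∸ toℕ t + toℕ j      <⟨ +-monoʳ-< (n ∸ toℕ t) (≰⇒> t≰j) ⟩
  n ∸ toℕ t + toℕ t      ≡⟨ m∸n+n≡m (<⇒≤ (toℕ<n t)) ⟩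
  n                      ∎
  where open ≤-Reasoning

rank-mod : ∀ {n} .{{_ : NonZero n}} (t j : Fin n) → rank t j ≡ (n ∸ toℕ t + toℕ j) % n
rank-mod {n} t j with toℕ t ≤? toℕ j
... | yes t≤j = begin
  rank t j                    ≡⟨ m<n⇒m%n≡m (rank<n t j) ⟨
  rank t j % n                ≡⟨ [m+n]%n≡m%n (rank t j) n ⟨
  (rank t j + n) % n          ≡⟨ cong (λ r → (r + n) % n) (rank-≤ t j t≤j) ⟩
  (toℕ j ∸ toℕ t + n) % n     ≡⟨ cong (_% n) wrap ⟩
  (n ∸ toℕ t + toℕ j) % n     ∎
  where
  open ≡-Reasoning
  wrap : toℕ j ∸ toℕ t + n ≡ n ∸ toℕ t + toℕ j
  wrap = begin
    toℕ j ∸ toℕ t + n    ≡⟨ +-∸-comm n t≤j ⟨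
    (toℕ j + n) ∸ toℕ t  ≡⟨ cong (_∸ toℕ t) (+-comm (toℕ j) n) ⟩
    (n + toℕ j) ∸ toℕ t  ≡⟨ +-∸-comm (toℕ j) (<⇒≤ (toℕ<n t)) ⟩
    n ∸ toℕ t + toℕ j    ∎
... | no  t≰j = begin
  rank t j                  ≡⟨ m<n⇒m%n≡m (rank<n t j) ⟨
  rank t j % n              ≡⟨ cong (_% n) (rank-> t j (≰⇒> t≰j)) ⟩
  (n ∸ toℕ t + toℕ j) % n   ∎
  where open ≡-Reasoning

rank-cocycle : ∀ {n} .{{_ : NonZero n}} (i t j : Fin n) → (rank t j + rank i t) % n ≡ rank i j
rank-cocycle {n} i t j = begin
  (rank t j + rank i t) % n                   ≡⟨ cong₂ (λ a b → (a + b) % n) (rank-mod t j) (rank-mod i t) ⟩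
  ((n ∸ t′ + j′) % n + (n ∸ i′ + t′) % n) % n  ≡⟨ %-distribˡ-+ (n ∸ t′ + j′) (n ∸ i′ + t′) n ⟨
  ((n ∸ t′ + j′) + (n ∸ i′ + t′)) % n          ≡⟨ cong (_% n) regroup ⟩
  ((n ∸ i′ + j′) + n) % n                      ≡⟨ [m+n]%n≡m%n (n ∸ i′ + j′) n ⟩
  (n ∸ i′ + j′) % n                            ≡⟨ rank-mod i j ⟨
  rank i j                                     ∎
  where
  open ≡-Reasoning
  i′ j′ t′ : ℕ
  i′ = toℕ i
  j′ = toℕ j
  t′ = toℕ t
  swap : ∀ a b c d → (a + c) + (b + d) ≡ (b + c) + (a + d)
  swap = solve-∀
  regroup : (n ∸ t′ + j′) + (n ∸ i′ + t′) ≡ (n ∸ i′ + j′) + n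
  regroup = trans (swap (n ∸ t′) (n ∸ i′) j′ t′) (cong ((n ∸ i′ + j′) +_) (m∸n+n≡m (<⇒≤ (toℕ<n t))))

<2n⇒residue : ∀ {m n} .{{_ : NonZero n}} → m < n + n → m ≡ m % n ⊎ m ≡ m % n + n
<2n⇒residue {m} {n} m<2n with m <? n
... | yes m<n = inj₁ (sym (m<n⇒m%n≡m m<n))
... | no  m≮n = inj₂ (begin
  m              ≡⟨ m∸n+n≡m n≤m ⟨
  (m ∸ n) + n    ≡⟨ cong (_+ n) residue ⟨
  m % n + n      ∎)
  where
  open ≡-Reasoning
  n≤m : n ≤ m
  n≤m = ≮⇒≥ m≮n
  residue : m % n ≡ m ∸ n
  residue = begin
    m % n              ≡⟨ cong (_% n) (m∸n+n≡m n≤m) ⟨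
    ((m ∸ n) + n) % n  ≡⟨ [m+n]%n≡m%n (m ∸ n) n ⟩
    (m ∸ n) % n        ≡⟨ m<n⇒m%n≡m (m<n+o⇒m∸n<o m n m<2n) ⟩
    m ∸ n              ∎

-- Passing from the order <_i to the order <_t, where t has rank k in <_i:
-- the elements of rank ≥ k move down by k, the first k elements wrap around
-- to the end.
rank-shift : ∀ {n} (i t j : Fin n) →
             (rank i t ≤ rank i j × rank t j + rank i t ≡ rank i j)
             ⊎ (rank i j < rank i t × rank t j + rank i t ≡ rank i j + n)
rank-shift {n} i t j = classify (<2n⇒residue (+-mono-< (rank<n t j) (rank<n i t)))
  where
  instance
    n≢0 : NonZero n
    n≢0 = nonZeroIndex i
  r k s : ℕ
  r = rank t j
  k = rank i t
  s = rank i j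
  classify : r + k ≡ (r + k) % n ⊎ r + k ≡ (r + k) % n + n →
             (k ≤ s × r + k ≡ s) ⊎ (s < k × r + k ≡ s + n)
  classify (inj₁ r+k≡[r+k]%n) = inj₁ (subst (k ≤_) r+k≡s (m≤n+m k r) , r+k≡s)
    where
    r+k≡s : r + k ≡ s
    r+k≡s = trans r+k≡[r+k]%n (rank-cocycle i t j)
  classify (inj₂ r+k≡[r+k]%n+n) = inj₂ (+-cancelʳ-< n s k s+n<k+n , r+k≡s+n)
    where
    r+k≡s+n : r + k ≡ s + n
    r+k≡s+n = trans r+k≡[r+k]%n+n (cong (_+ n) (rank-cocycle i t j))
    s+n<k+n : s + n < k + n
    s+n<k+n = subst₂ _<_ r+k≡s+n (+-comm n k) (+-monoˡ-< k (rank<n t j))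

-- Every rank k < n is attained: by t = i + k (mod n).
rank-surjective : ∀ {n} (i : Fin n) (k : ℕ) → k < n → Σ (Fin n) (λ t → rank i t ≡ k)
rank-surjective {n} i k k<n = t , (begin
  rank i t                              ≡⟨ rank-mod i t ⟩
  (n ∸ toℕ i + toℕ t) % n               ≡⟨ cong (λ x → (n ∸ toℕ i + x) % n) (toℕ-fromℕ< i+k%n<n) ⟩
  (n ∸ toℕ i + (toℕ i + k) % n) % n     ≡⟨ %-distribˡ-+ (n ∸ toℕ i) ((toℕ i + k) % n) n ⟩
  ((n ∸ toℕ i) % n + (toℕ i + k) % n % n) % n
                                        ≡⟨ cong (λ x → ((n ∸ toℕ i) % n + x) % n) (m%n%n≡m%n (toℕ i + k) n) ⟩
  ((n ∸ toℕ i) % n + (toℕ i + k) % n) % n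
                                        ≡⟨ %-distribˡ-+ (n ∸ toℕ i) (toℕ i + k) n ⟨
  (n ∸ toℕ i + (toℕ i + k)) % n         ≡⟨ cong (_% n) unwrap ⟩
  (k + n) % n                           ≡⟨ [m+n]%n≡m%n k n ⟩
  k % n                                 ≡⟨ m<n⇒m%n≡m k<n ⟩
  k                                     ∎)
  where
  open ≡-Reasoning
  instance
    n≢0 : NonZero n
    n≢0 = nonZeroIndex i
  i+k%n<n : (toℕ i + k) % n < n
  i+k%n<n = m%n<n (toℕ i + k) n
  t : Fin n
  t = fromℕ< i+k%n<n
  unwrap : n ∸ toℕ i + (toℕ i + k) ≡ k + n
  unwrap = begin
    n ∸ toℕ i + (toℕ i + k)  ≡⟨ +-assoc (n ∸ toℕ i) (toℕ i) k ⟨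
    n ∸ toℕ i + toℕ i + k    ≡⟨ cong (_+ k) (m∸n+n≡m (<⇒≤ (toℕ<n i))) ⟩
    n + k                    ≡⟨ +-comm n k ⟩
    k + n                    ∎

pairs-on : ∀ {A : Set} {P : A → Set} {R : A → A → Set} {xs : List A} →
           All P xs → AllPairs (λ x y → P x → P y → R x y) xs → AllPairs R xs
pairs-on []         []         = []
pairs-on (px ∷ pxs) (rx ∷ rxs) = All.zipWith (λ (py , r) → r px py) (pxs , rx) ∷ pairs-on pxs rxs

rank-increasing : ∀ {n} (t : Fin n) → AllPairs (λ x y → rank t x < rank t y) (orderedFin t)
rank-increasing {n} t = AllPairs.++⁺ (on-part P after-t) (on-part (∁ P) before-t)
  (All.map (λ {x} Px → All.map (λ {y} ¬Py → across Px ¬Py) (all-filter (T? ∘ ∁ P) (allFin n)))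
           (all-filter (T? ∘ P) (allFin n)))
  where
  P : Subset n
  P j = toℕ t ≤ᵇ toℕ j
  t≤ : ∀ {x} → T (P x) → toℕ t ≤ toℕ x
  t≤ {x} = ≤ᵇ⇒≤ (toℕ t) (toℕ x)
  <t : ∀ {y} → T (∁ P y) → toℕ y < toℕ t
  <t ¬Py = ≤ᵇ-false⇒> (Equivalence.to T-not-≡ ¬Py)
  on-part : (Q : Subset n) → (∀ {x y} → T (Q x) → T (Q y) → toℕ x < toℕ y → rank t x < rank t y) →
            AllPairs (λ x y → rank t x < rank t y) (filterᵇ Q (allFin n))
  on-part Q mono = pairs-on (all-filter (T? ∘ Q) (allFin n))
    (AllPairs.filter⁺ (T? ∘ Q) (AllPairs.tabulate⁺-< (λ x<y Qx Qy → mono Qx Qy x<y)))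
  after-t : ∀ {x y} → T (P x) → T (P y) → toℕ x < toℕ y → rank t x < rank t y
  after-t {x} {y} Px Py x<y = subst₂ _<_ (sym (rank-≤ t x (t≤ Px))) (sym (rank-≤ t y (t≤ Py)))
                                (∸-monoˡ-< x<y (t≤ Px))
  before-t : ∀ {x y} → T (∁ P x) → T (∁ P y) → toℕ x < toℕ y → rank t x < rank t y
  before-t {x} {y} ¬Px ¬Py x<y = subst₂ _<_ (sym (rank-> t x (<t ¬Px))) (sym (rank-> t y (<t ¬Py)))
                                   (+-monoʳ-< (n ∸ toℕ t) x<y)
  across : ∀ {x y} → T (P x) → T (∁ P y) → rank t x < rank t y
  across {x} {y} Px ¬Py = begin-strict
    rank t x           ≡⟨ rank-≤ t x (t≤ Px) ⟩
    toℕ x ∸ toℕ t      <⟨ ∸-monoˡ-< (toℕ<n x) (t≤ Px) ⟩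
    n ∸ toℕ t          ≤⟨ m≤m+n (n ∸ toℕ t) (toℕ y) ⟩
    n ∸ toℕ t + toℕ y  ≡⟨ rank-> t y (<t ¬Py) ⟨
    rank t y           ∎
    where open ≤-Reasoning

initial : ∀ {n} → Fin n → ℕ → Subset n
initial t k j = rank t j <ᵇ k

card-initial-all : ∀ {n} (t : Fin n) {k : ℕ} (A : Subset n) → n ≤ k → card (initial t k ∩ A) ≡ card A
card-initial-all {n} t A n≤k =
  count-cong (λ j → cong (_∧ A j) (<ᵇ-true (<-≤-trans (rank<n t j) n≤k))) (allFin n)

sortedRanks : ∀ {n} → Fin n → Subset n → List ℕ
sortedRanks t A = map (rank t) (sorted t A)

length-sortedRanks : ∀ {n} (t : Fin n) (A : Subset n) → length (sortedRanks t A) ≡ card A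
length-sortedRanks t A = trans (length-map (rank t) (sorted t A)) (count-orderedFin t A)

countBelow-sortedRanks : ∀ {n} (t : Fin n) (A : Subset n) (k : ℕ) →
                         countBelow k (sortedRanks t A) ≡ card (initial t k ∩ A)
countBelow-sortedRanks t A k = begin
  countBelow k (sortedRanks t A)                 ≡⟨ count-map (_<ᵇ k) (rank t) (sorted t A) ⟩
  count (initial t k) (sorted t A)               ≡⟨ count-filter (initial t k) A (orderedFin t) ⟩
  count (initial t k ∩ A) (orderedFin t)         ≡⟨ count-orderedFin t (initial t k ∩ A) ⟩
  card (initial t k ∩ A)                         ∎
  where open ≡-Reasoning

sortedRanks-increasing : ∀ {n} (t : Fin n) (A : Subset n) → AllPairs _<_ (sortedRanks t A)
sortedRanks-increasing t A = AllPairs.map⁺ (AllPairs.filter⁺ (T? ∘ A) (rank-increasing t))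

gale⇒initialCounts : ∀ {n} (t : Fin n) (A B : Subset n) → GaleLeq t A B →
                     card A ≡ card B × (∀ k → card (initial t k ∩ B) ≤ card (initial t k ∩ A))
gale⇒initialCounts t A B A≤B =
  trans (sym (length-sortedRanks t A)) (trans (Pointwise-length ranks≤) (length-sortedRanks t B)) ,
  λ k → subst₂ _≤_ (countBelow-sortedRanks t B k) (countBelow-sortedRanks t A k)
                   (pointwise⇒countBelow ranks≤ k)
  where
  ranks≤ : Pointwise _≤_ (sortedRanks t A) (sortedRanks t B)
  ranks≤ = Pointwise.map⁺ (rank t) (rank t) A≤B

initialCounts⇒gale : ∀ {n} (t : Fin n) (A B : Subset n) → card A ≡ card B →
                     (∀ k → card (initial t k ∩ B) ≤ card (initial t k ∩ A)) → GaleLeq t A B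
initialCounts⇒gale t A B |A|≡|B| counts = Pointwise.map⁻ (rank t) (rank t)
  (countBelow⇒pointwise (sortedRanks-increasing t A) (sortedRanks-increasing t B)
    (trans (length-sortedRanks t A) (trans |A|≡|B| (sym (length-sortedRanks t B))))
    (λ k → subst₂ _≤_ (sym (countBelow-sortedRanks t B k)) (sym (countBelow-sortedRanks t A k)) (counts k)))

module Necklaces {n : ℕ} (d : DecPerm n) where

  π : Permutation′ n
  π = perm d

  J : Fin n → Subset n
  J = upperNecklace d

  fixedNeg-nonfixed : ∀ x → ¬ (π ⟨$⟩ʳ x ≡ x) → fixedNeg d x ≡ false
  fixedNeg-nonfixed x πx≢x with π ⟨$⟩ʳ x ≟ x
  ... | yes πx≡x = contradiction πx≡x πx≢x
  ... | no  _    = refl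

  -- π and π⁻¹ have the same fixed points, hence the same coloured ones.
  fixedNeg-inverse : ∀ j → fixedNeg d (π ⟨$⟩ˡ j) ≡ fixedNeg d j
  fixedNeg-inverse j = by-fixedness (π ⟨$⟩ʳ j ≟ j)
    where
    by-fixedness : Dec (π ⟨$⟩ʳ j ≡ j) → fixedNeg d (π ⟨$⟩ˡ j) ≡ fixedNeg d j
    by-fixedness (yes πj≡j) = cong (fixedNeg d) (trans (cong (π ⟨$⟩ˡ_) (sym πj≡j)) (inverseˡ π))
    by-fixedness (no  πj≢j) = trans (fixedNeg-nonfixed (π ⟨$⟩ˡ j) π⁻¹j-nonfixed) (sym (fixedNeg-nonfixed j πj≢j))
      where
      π⁻¹j-nonfixed : ¬ (π ⟨$⟩ʳ (π ⟨$⟩ˡ j) ≡ π ⟨$⟩ˡ j)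
      π⁻¹j-nonfixed ππ⁻¹j≡π⁻¹j = πj≢j (begin
        π ⟨$⟩ʳ j            ≡⟨ cong (π ⟨$⟩ʳ_) (trans (sym ππ⁻¹j≡π⁻¹j) (inverseʳ π)) ⟨
        π ⟨$⟩ʳ (π ⟨$⟩ˡ j)    ≡⟨ inverseʳ π ⟩
        j                   ∎)
        where open ≡-Reasoning

  image-upperNecklace : ∀ i j → image π (J i) j ≡ necklace d i j
  image-upperNecklace i j = cong₂ _∨_ (cong (_<[ i ] (π ⟨$⟩ˡ j)) (inverseʳ π)) (fixedNeg-inverse j)

  card-image : (A : Subset n) → card (image π A) ≡ card A
  card-image A = card-permute (flip π) A

  module Window (i t : Fin n) where

    k : ℕ
    k = rank i t

    W : Subset n
    W = initial i k

    in-window : ∀ {x} → W x ≡ true → rank i x < k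
    in-window {x} = <ᵇ-true⇒< {rank i x} {k}

    not-in-window : ∀ {x} → W x ≡ false → k ≤ rank i x
    not-in-window {x} = <ᵇ-false⇒≥ {rank i x} {k}

    inside : ∀ {x} → W x ≡ true → rank t x + k ≡ rank i x + n
    inside {x} Wx with rank-shift i t x
    ... | inj₁ (k≤s , _)  = contradiction (in-window Wx) (≤⇒≯ k≤s)
    ... | inj₂ (_ , r+k≡s+n) = r+k≡s+n

    outside : ∀ {x} → W x ≡ false → rank t x + k ≡ rank i x
    outside {x} Wx with rank-shift i t x
    ... | inj₁ (_ , r+k≡s) = r+k≡s
    ... | inj₂ (s<k , _)  = contradiction (not-in-window Wx) (<⇒≱ s<k)

    same-order : ∀ {x y} → W x ≡ true → W y ≡ true → (y <[ t ] x) ≡ (y <[ i ] x)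
    same-order {x} {y} Wx Wy = <ᵇ-shift {rank t y} {rank t x} {rank i y} {rank i x} (inside Wy) (inside Wx)

    window-last : ∀ {x y} → W x ≡ true → W y ≡ false → (y <[ t ] x) ≡ true
    window-last {x} {y} Wx Wy = <ᵇ-true (+-cancelʳ-< k (rank t y) (rank t x) (begin-strict
      rank t y + k  ≡⟨ outside Wy ⟩
      rank i y      <⟨ rank<n i y ⟩
      n             ≤⟨ m≤n+m n (rank i x) ⟩
      rank i x + n  ≡⟨ inside Wx ⟨
      rank t x + k  ∎))
      where open ≤-Reasoning

    window-first : ∀ {x y} → W x ≡ false → W y ≡ true → (y <[ i ] x) ≡ true
    window-first Wx Wy = <ᵇ-true (<-≤-trans (in-window Wy) (not-in-window Wx))

    window-complement : ∀ j → W j ≡ ∁ (initial t (n ∸ k)) j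
    window-complement j with W j in Wj
    ... | true  = cong not (sym (<ᵇ-false (m≤n+o⇒m∸n≤o n k (begin
      n                 ≤⟨ m≤n+m n (rank i j) ⟩
      rank i j + n      ≡⟨ inside Wj ⟨
      rank t j + k      ≡⟨ +-comm (rank t j) k ⟩
      k + rank t j      ∎))))
      where open ≤-Reasoning
    ... | false = cong not (sym (<ᵇ-true (m+n≤o⇒m≤o∸n (suc (rank t j)) (begin
      suc (rank t j) + k  ≡⟨⟩
      suc (rank t j + k)  ≡⟨ cong suc (outside Wj) ⟩
      suc (rank i j)      ≤⟨ rank<n i j ⟩
      n                   ∎))))
      where open ≤-Reasoning

    W′ : Subset n
    W′ = W ∘ (π ⟨$⟩ʳ_)

    upper-t-in-both : ∀ x → (W′ ∩ (W ∩ J t)) x ≡ (W′ ∩ (W ∩ J i)) x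
    upper-t-in-both x with W′ x in W′x | W x in Wx
    ... | true  | true  = cong (_∨ fixedNeg d x) (same-order Wx W′x)
    ... | true  | false = refl
    ... | false | _     = refl

    upper-t-leaving : ∀ x → (∁ W′ ∩ (W ∩ J t)) x ≡ (∁ W′ ∩ W) x
    upper-t-leaving x with W′ x in W′x | W x in Wx
    ... | false | true  = cong (_∨ fixedNeg d x) (window-last Wx W′x)
    ... | false | false = refl
    ... | true  | _     = refl

    upper-i-in-both : ∀ x → (W ∩ (W′ ∩ J i)) x ≡ (W′ ∩ (W ∩ J i)) x
    upper-i-in-both x with W′ x | W x
    ... | true  | true  = refl
    ... | true  | false = refl
    ... | false | true  = refl
    ... | false | false = refl

    upper-i-entering : ∀ x → (∁ W ∩ (W′ ∩ J i)) x ≡ (∁ W ∩ W′) x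
    upper-i-entering x with W′ x in W′x | W x in Wx
    ... | true  | false = cong (_∨ fixedNeg d x) (window-first Wx W′x)
    ... | true  | true  = refl
    ... | false | _     = refl

    window-upper : card (W ∩ J t) ≡ card (W′ ∩ (W ∩ J i)) + card (∁ W′ ∩ W)
    window-upper = trans (count-split W′ (W ∩ J t) (allFin n))
      (cong₂ _+_ (count-cong upper-t-in-both (allFin n)) (count-cong upper-t-leaving (allFin n)))

    window-image : card (W ∩ image π (J i)) ≡ card (W′ ∩ (W ∩ J i)) + card (∁ W ∩ W′)
    window-image = begin
      card (W ∩ image π (J i))                              ≡⟨ card-permute π (W ∩ image π (J i)) ⟨
      card ((W ∩ image π (J i)) ∘ (π ⟨$⟩ʳ_))                 ≡⟨ count-cong pull-back (allFin n) ⟩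
      card (W′ ∩ J i)                                       ≡⟨ count-split W (W′ ∩ J i) (allFin n) ⟩
      card (W ∩ (W′ ∩ J i)) + card (∁ W ∩ (W′ ∩ J i))       ≡⟨ cong₂ _+_ (count-cong upper-i-in-both (allFin n))
                                                                        (count-cong upper-i-entering (allFin n)) ⟩
      card (W′ ∩ (W ∩ J i)) + card (∁ W ∩ W′)               ∎
      where
      open ≡-Reasoning
      pull-back : ∀ x → (W ∩ image π (J i)) (π ⟨$⟩ʳ x) ≡ (W′ ∩ J i) x
      pull-back x = cong (λ y → W′ x ∧ J i y) (inverseˡ π)

    -- The window meets J_t and π(J_i) in equally many elements: the elements
    -- leaving W under π balance those entering it.
    window-upper≡image : card (W ∩ J t) ≡ card (W ∩ image π (J i))
    window-upper≡image = begin
      card (W ∩ J t)                                 ≡⟨ window-upper ⟩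
      card (W′ ∩ (W ∩ J i)) + card (∁ W′ ∩ W)        ≡⟨ cong (card (W′ ∩ (W ∩ J i)) +_)
                                                          (card-difference W W′ (sym (card-permute π W))) ⟩
      card (W′ ∩ (W ∩ J i)) + card (∁ W ∩ W′)        ≡⟨ window-image ⟨
      card (W ∩ image π (J i))                       ∎
      where open ≡-Reasoning

    -- H ≤_t J_t bounds the part of H in the window (the last k elements of <_t).
    window-bound : (H : Subset n) → InSM t (J t) H → card (W ∩ H) ≤ card (W ∩ image π (J i))
    window-bound H (|H|≡|Jt| , H≤Jt) = begin
      card (W ∩ H)                ≡⟨ count-cong (λ j → cong (_∧ H j) (window-complement j)) (allFin n) ⟩
      card (∁ q ∩ H)              ≤⟨ card-complement-≤ q H (J t) |H|≡|Jt| qJt≤qH ⟩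
      card (∁ q ∩ J t)            ≡⟨ count-cong (λ j → cong (_∧ J t j) (window-complement j)) (allFin n) ⟨
      card (W ∩ J t)              ≡⟨ window-upper≡image ⟩
      card (W ∩ image π (J i))    ∎
      where
      open ≤-Reasoning
      q : Subset n
      q = initial t (n ∸ k)
      qJt≤qH : card (q ∩ J t) ≤ card (q ∩ H)
      qJt≤qH = proj₂ (gale⇒initialCounts t H (J t) H≤Jt) (n ∸ k)

  initial-bound : (H : Subset n) → InMtilde d H → ∀ i k →
                  card (initial i k ∩ H) ≤ card (initial i k ∩ image π (J i))
  initial-bound H H∈M i k with k <? n
  ... | no k≮n = ≤-reflexive (begin
    card (initial i k ∩ H)              ≡⟨ card-initial-all i H (≮⇒≥ k≮n) ⟩
    card H                              ≡⟨ proj₁ (H∈M i) ⟩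
    card (J i)                          ≡⟨ card-image (J i) ⟨
    card (image π (J i))                ≡⟨ card-initial-all i (image π (J i)) (≮⇒≥ k≮n) ⟨
    card (initial i k ∩ image π (J i))  ∎)
    where open ≡-Reasoning
  ... | yes k<n with rank-surjective i k k<n
  ...   | t , rank-t≡k = subst (λ m → card (initial i m ∩ H) ≤ card (initial i m ∩ image π (J i)))
                               rank-t≡k (Window.window-bound i t H (H∈M t))

mainTheorem4 : (n : ℕ) (d : DecPerm n) (H : Subset n) → InMtilde d H →
    (i : Fin n) →
      GaleLeq i (image (perm d) (upperNecklace d i)) H
      × (∀ j → image (perm d) (upperNecklace d i) j ≡ necklace d i j)
mainTheorem4 n d H H∈M i =
  initialCounts⇒gale i (image π (J i)) H |π[Ji]|≡|H| (initial-bound H H∈M i) ,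
  image-upperNecklace i
  where
  open Necklaces d
  |π[Ji]|≡|H| : card (image π (J i)) ≡ card H
  |π[Ji]|≡|H| = trans (card-image (J i)) (sym (proj₁ (H∈M i)))
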